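{- If $G$ is a finite simple graph whose degeneracy is at least $k$, then $\mathrm{Hun}(G)\ge k$.
   Context: The degeneracy of $G$ is the maximum, over all subgraphs of $G$, of their minimum degree. Hunter strategy on $G$: finite sequence $H=(H_1,\dots,H_m)$ of multisets of vertices; with $N(S)$ the set of vertices adjacent to some vertex of $S$, set $R_H(0)=V(G)$, $R_H(i)=N(R_H(i-1)\setminus H_i)$; $H$ is winning if $R_H(i)=\emptyset$ for some $i$. $\mathrm{Hun}(G)$ is the minimum over winning strategies of $\max_i|H_i|$ (multiplicities counted). -}

module Defs where

open import Data.Nat using (ℕ; zero; suc; _+_; _≤_; _⊔_)
open import Data.Bool using (Bool; true; false; _∧_; not; if_then_else_)
open import Data.Fin using (Fin; _≟_)
open import Data.List using (List; []; _∷_; length; map; foldr; allFin)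
open import Data.Bool.ListAction using (any)
open import Data.Product using (Σ; _×_; ∃; _,_)
open import Data.Sum using (_⊎_)
open import Relation.Binary.PropositionalEquality using (_≡_)
open import Relation.Nullary.Decidable using (⌊_⌋)

record Graph (n : ℕ) : Set where
  field
    adj    : Fin n → Fin n → Bool
    sym    : ∀ u v → adj u v ≡ adj v u
    irrefl : ∀ v → adj v v ≡ false
open Graph public

VSet : ℕ → Set
VSet n = Fin n → Bool

count : ∀ {n} → (Fin n → Bool) → ℕ
count {n} p = foldr (λ u c → if p u then suc c else c) 0 (allFin n)

record Subgraph {n : ℕ} (G : Graph n) : Set where
  field
    S      : VSet n
    E      : Fin n → Fin n → Bool
    E⊆adj  : ∀ u v → E u v ≡ true → adj G u v ≡ true
    E-sym  : ∀ u v → E u v ≡ E v u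
    E⊆S    : ∀ u v → E u v ≡ true → S u ≡ true
open Subgraph public

degIn : ∀ {n} {G : Graph n} → Subgraph G → Fin n → ℕ
degIn H v = count (E H v)

MinDeg≥ : ∀ {n} {G : Graph n} → Subgraph G → ℕ → Set
MinDeg≥ {n} H k = ∀ (v : Fin n) → S H v ≡ true → k ≤ degIn H v

-- degeneracy(G) ≥ k : some (nonempty) subgraph of G has minimum degree ≥ k
-- (degeneracy = max over nonempty subgraphs of their minimum degree).
Degeneracy≥ : ∀ {n} → Graph n → ℕ → Set
Degeneracy≥ {n} G k =
  Σ (Subgraph G) λ H → (Σ (Fin n) λ v → S H v ≡ true) × MinDeg≥ H k

-- Hunter strategies: H_i is a multiset of vertices, represented as a list.
Strategy : ℕ → Set
Strategy n = List (List (Fin n))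

nbhd : ∀ {n} → Graph n → VSet n → VSet n
nbhd {n} G X v = any (λ u → X u ∧ adj G u v) (allFin n)

minus : ∀ {n} → VSet n → List (Fin n) → VSet n
minus X h v = X v ∧ not (any (λ u → ⌊ u ≟ v ⌋) h)

IsEmpty : ∀ {n} → VSet n → Set
IsEmpty {n} X = ∀ (v : Fin n) → X v ≡ false

WinsFrom : ∀ {n} → Graph n → VSet n → Strategy n → Set
WinsFrom G R []       = IsEmpty R
WinsFrom G R (h ∷ hs) = IsEmpty R ⊎ WinsFrom G (nbhd G (minus R h)) hs

Winning : ∀ {n} → Graph n → Strategy n → Set
Winning G H = WinsFrom G (λ _ → true) H

-- max_i |H_i| (multiplicities counted); 0 for the empty strategy
width : ∀ {n} → Strategy n → ℕ
width H = foldr _⊔_ 0 (map length H)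

-- Hun(G) ≥ k  (Hun is the minimum of width over winning strategies)
Hun≥ : ∀ {n} → Graph n → ℕ → Set
Hun≥ G k = ∀ H → Winning G H → k ≤ width H

-- A subgraph H of minimum degree at least k survives every round that removes
-- fewer than k vertices: each vertex v of H has at least k neighbours in H, so
-- one of them, u, escapes the removed multiset, and if u was still a possible
-- position then v is one after the round.  Since H is nonempty, the set of
-- possible positions can only become empty after a round of size at least k.
module Submission where

open import Defs hiding (sym)
open import Data.Nat using (ℕ; zero; suc; _+_; _≤_; _<_; z≤n; s≤s)
open import Data.Nat.Properties
  using (≤-trans; ≤-antisym; ≤-reflexive; <-≤-trans; m≤n⇒m≤1+n; +-suc; +-monoʳ-≤; n≤1+n;
         +-cancelʳ-<; _≤?_; ≰⇒>; m≤m⊔n; m≤n⊔m; module ≤-Reasoning)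
open import Data.Bool using (Bool; true; false; _∧_; _∨_; not; if_then_else_)
open import Data.Bool.Properties using (∨-inverseˡ; T-≡)
open import Data.Fin using (Fin; zero; suc; _≟_)
open import Data.List using (List; []; _∷_; length; foldr; allFin)
open import Data.List.Properties using (map-tabulate; foldr-map)
open import Data.List.Membership.Propositional using (lose)
open import Data.List.Membership.Propositional.Properties using (∈-allFin)
open import Data.List.Relation.Unary.Any.Properties using (any⁺)
open import Data.Bool.ListAction using (any)
open import Data.Product using (∃; _×_; _,_; map)
open import Data.Sum using (inj₁; inj₂)
open import Function using (_∘_; id; Equivalence)
open import Relation.Binary.PropositionalEquality
  using (_≡_; refl; sym; trans; cong; cong₂; module ≡-Reasoning)
open import Relation.Nullary using (¬_; yes; no; contradiction)
open import Relation.Nullary.Decidable using (⌊_⌋; isYes≗does)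

private
  variable
    n : ℕ

infix 4 _⊆_

_⊆_ : VSet n → VSet n → Set
X ⊆ Y = ∀ v → X v ≡ true → Y v ≡ true

NonEmpty : VSet n → Set
NonEmpty X = ∃ λ v → X v ≡ true

mem : List (Fin n) → VSet n
mem h v = any (λ u → ⌊ u ≟ v ⌋) h

count-suc : (p : VSet (suc n)) →
            count p ≡ (if p zero then suc (count (p ∘ suc)) else count (p ∘ suc))
count-suc {n} p = cong (λ c → if p zero then suc c else c)
  (trans (cong (foldr step 0) (sym (map-tabulate id suc))) (foldr-map step suc 0 (allFin n)))
  where
  step : Fin (suc n) → ℕ → ℕ
  step u c = if p u then suc c else c

count-false : ∀ n → count {n} (λ _ → false) ≡ 0
count-false zero    = refl
count-false (suc n) = trans (count-suc {n} (λ _ → false)) (count-false n)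

count-mono : {p q : VSet n} → p ⊆ q → count p ≤ count q
count-mono {zero}  p⊆q = z≤n
count-mono {suc n} {p} {q} p⊆q rewrite count-suc p | count-suc q
  with p zero in p₀ | q zero in q₀ | count-mono {p = p ∘ suc} {q ∘ suc} (p⊆q ∘ suc)
... | false | false | IH = IH
... | false | true  | IH = m≤n⇒m≤1+n IH
... | true  | true  | IH = s≤s IH
... | true  | false | _  = contradiction (trans (sym (p⊆q zero p₀)) q₀) λ ()

count-cong : {p q : VSet n} → (∀ u → p u ≡ q u) → count p ≡ count q
count-cong p≗q = ≤-antisym (count-mono (λ u pu → trans (sym (p≗q u)) pu))
                           (count-mono (λ u qu → trans (p≗q u) qu))

⌊suc≟suc⌋ : (x y : Fin n) → ⌊ suc x ≟ suc y ⌋ ≡ ⌊ x ≟ y ⌋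
⌊suc≟suc⌋ x y = trans (isYes≗does (suc x ≟ suc y)) (sym (isYes≗does (x ≟ y)))

count-≟ : (x : Fin n) → count (λ v → ⌊ x ≟ v ⌋) ≡ 1
count-≟ {suc n} zero    = trans (count-suc {n} (λ v → ⌊ zero ≟ v ⌋)) (cong suc (count-false n))
count-≟ {suc n} (suc x) = begin
  count (λ v → ⌊ suc x ≟ v ⌋)        ≡⟨ count-suc {n} (λ v → ⌊ suc x ≟ v ⌋) ⟩
  count (λ v → ⌊ suc x ≟ suc v ⌋)    ≡⟨ count-cong (⌊suc≟suc⌋ x) ⟩
  count (λ v → ⌊ x ≟ v ⌋)            ≡⟨ count-≟ x ⟩
  1                                  ∎
  where open ≡-Reasoning

count-∨ : (p q : VSet n) → count (λ u → p u ∨ q u) ≤ count p + count q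
count-∨ {zero}  p q = z≤n
count-∨ {suc n} p q rewrite count-suc (λ u → p u ∨ q u) | count-suc p | count-suc q
  with p zero | q zero | count-∨ (p ∘ suc) (q ∘ suc)
... | false | false | IH = IH
... | true  | false | IH = s≤s IH
... | false | true  | IH = ≤-trans (s≤s IH) (≤-reflexive (sym (+-suc _ _)))
... | true  | true  | IH = s≤s (≤-trans IH (+-monoʳ-≤ _ (n≤1+n _)))

count≤count-∖+count : (p q : VSet n) → count p ≤ count (λ u → p u ∧ not (q u)) + count q
count≤count-∖+count p q = ≤-trans (count-mono cover) (count-∨ _ q)
  where
  cover : p ⊆ (λ u → (p u ∧ not (q u)) ∨ q u)
  cover u pu rewrite pu = ∨-inverseˡ (q u)

count-mem≤length : (h : List (Fin n)) → count (mem h) ≤ length h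
count-mem≤length {n} []      = ≤-reflexive (count-false n)
count-mem≤length     (x ∷ h) = begin
  count (mem (x ∷ h))                      ≤⟨ count-∨ (λ v → ⌊ x ≟ v ⌋) (mem h) ⟩
  count (λ v → ⌊ x ≟ v ⌋) + count (mem h)  ≡⟨ cong (_+ count (mem h)) (count-≟ x) ⟩
  suc (count (mem h))                      ≤⟨ s≤s (count-mem≤length h) ⟩
  suc (length h)                           ∎
  where open ≤-Reasoning

0<count⇒NonEmpty : (p : VSet n) → 0 < count p → NonEmpty p
0<count⇒NonEmpty {suc n} p pos rewrite count-suc p with p zero in p₀
... | true  = zero , p₀
... | false = map suc id (0<count⇒NonEmpty (p ∘ suc) pos)

length<count⇒minus-NonEmpty : (p : VSet n) (h : List (Fin n)) →
                              length h < count p → NonEmpty (minus p h)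
length<count⇒minus-NonEmpty p h h<p =
  0<count⇒NonEmpty (minus p h) (+-cancelʳ-< (length h) 0 _ (<-≤-trans h<p p≤))
  where
  p≤ : count p ≤ count (minus p h) + length h
  p≤ = ≤-trans (count≤count-∖+count p (mem h)) (+-monoʳ-≤ _ (count-mem≤length h))

∧-≡-true : {a b : Bool} → a ∧ b ≡ true → a ≡ true × b ≡ true
∧-≡-true {true} b≡true = refl , b≡true

nbhd-intro : (G : Graph n) {X : VSet n} {u v : Fin n} →
             X u ≡ true → adj G u v ≡ true → nbhd G X v ≡ true
nbhd-intro G {u = u} Xu uv = Equivalence.to T-≡
  (any⁺ _ (lose (∈-allFin u) (Equivalence.from T-≡ (cong₂ _∧_ Xu uv))))

NonEmpty⇒¬IsEmpty : {X Y : VSet n} → X ⊆ Y → NonEmpty X → ¬ IsEmpty Y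
NonEmpty⇒¬IsEmpty X⊆Y (v , Xv) Y≡∅ = contradiction (trans (sym (X⊆Y v Xv)) (Y≡∅ v)) λ ()

module _ {G : Graph n} (H : Subgraph G) {k : ℕ} (δ≥k : MinDeg≥ H k) where

  S⊆nbhd-minus : {R : VSet n} (h : List (Fin n)) → length h < k →
                 S H ⊆ R → S H ⊆ nbhd G (minus R h)
  S⊆nbhd-minus h h<k S⊆R v Sv
    with u , vu∈E∖h ← length<count⇒minus-NonEmpty (E H v) h (<-≤-trans h<k (δ≥k v Sv))
    with vu , u∉h ← ∧-≡-true vu∈E∖h =
    nbhd-intro G (cong₂ _∧_ (S⊆R u (E⊆S H u v uv)) u∉h) (E⊆adj H u v uv)
    where
    uv : E H u v ≡ true
    uv = trans (E-sym H u v) vu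

  k≤width : {R : VSet n} (hs : Strategy n) → NonEmpty (S H) → S H ⊆ R →
            WinsFrom G R hs → k ≤ width hs
  k≤width []       S≢∅ S⊆R R≡∅        = contradiction R≡∅ (NonEmpty⇒¬IsEmpty S⊆R S≢∅)
  k≤width (h ∷ hs) S≢∅ S⊆R (inj₁ R≡∅) = contradiction R≡∅ (NonEmpty⇒¬IsEmpty S⊆R S≢∅)
  k≤width (h ∷ hs) S≢∅ S⊆R (inj₂ wins) with k ≤? length h
  ... | yes k≤h = ≤-trans k≤h (m≤m⊔n (length h) (width hs))
  ... | no  k≰h = ≤-trans (k≤width hs S≢∅ (S⊆nbhd-minus h (≰⇒> k≰h) S⊆R) wins)
                          (m≤n⊔m (length h) (width hs))

lemma2p7 : (n : ℕ) (G : Graph n) (k : ℕ) → Degeneracy≥ G k → Hun≥ G k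
lemma2p7 n G k (H , S≢∅ , δ≥k) hs wins = k≤width H δ≥k hs S≢∅ (λ _ _ → refl) wins
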